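{- Let $w$ be a binary word over $\{0,1\}$ that is not prefix normal. Then there exist two abelian equivalent words $u$ and $u'$ such that $u0$ is a prefix of $w$ and $1u'$ is a factor of $w$.
   Context: A binary word $w$ is prefix normal if for every prefix $p$ and every factor (contiguous subword) $f$ of $w$ with $|p|=|f|$, the number of $1$'s in $p$ is at least the number of $1$'s in $f$. Two words are abelian equivalent if each letter occurs the same number of times in both. -}

module Defs where

open import Data.Nat using (ℕ; zero; suc; _≤_)
open import Data.List using (List; []; _∷_; _++_; length)
open import Data.Product using (Σ; ∃; ∃-syntax; _×_)
open import Relation.Binary.PropositionalEquality using (_≡_)

data Bit : Set where
  b0 b1 : Bit

Word : Set
Word = List Bit

occ : Bit → Word → ℕ
occ a [] = 0
occ b0 (b0 ∷ w) = suc (occ b0 w)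
occ b0 (b1 ∷ w) = occ b0 w
occ b1 (b0 ∷ w) = occ b1 w
occ b1 (b1 ∷ w) = suc (occ b1 w)

ones : Word → ℕ
ones = occ b1

IsPrefix : Word → Word → Set
IsPrefix p w = ∃[ s ] (p ++ s ≡ w)

IsFactor : Word → Word → Set
IsFactor f w = ∃[ x ] ∃[ y ] (x ++ f ++ y ≡ w)

PrefixNormal : Word → Set
PrefixNormal w = (p f : Word) → IsPrefix p w → IsFactor f w →
                 length p ≡ length f → ones f ≤ ones p

AbelianEquiv : Word → Word → Set
AbelianEquiv u v = (a : Bit) → occ a u ≡ occ a v

-- Take the least n such that some factor f of length n + 1 has more 1's than the
-- prefix p of length n + 1. Write p = u a and f = c u′. By minimality the prefix u
-- has at least as many 1's as the factor u′ of length n, and counting 1's forces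
-- a = 0, c = 1 and equally many 1's in u and u′, which have the same length.
-- Constructively, the least n is found by a bounded search, since violations of a
-- given length are decidable.
module Submission where

open import Defs
open import Data.Empty using (⊥-elim)
open import Data.List using (List; []; _∷_; _++_; _∷ʳ_; length; take; drop; _∷ʳ′_; initLast)
open import Data.List.Properties
  using (++-assoc; length-++; length-++-≤ˡ; length-++-≤ʳ; length-take; take++drop≡id)
open import Data.Nat using (ℕ; zero; suc; _+_; _≤_; _<_; _≤?_; _<?_)
open import Data.Nat.Properties
open import Data.Product using (∃-syntax; _×_; _,_)
open import Data.Sum using (_⊎_; inj₁; inj₂)
open import Level using (Level)
open import Relation.Nullary using (¬_; Dec; yes; no)
open import Relation.Nullary.Decidable using (map′; _×-dec_)
open import Relation.Binary.PropositionalEquality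

private variable
  ℓ q : Level
  A : Set ℓ

module _ {P : ℕ → Set ℓ} (P? : ∀ n → Dec (P n)) (¬P0 : ¬ P 0) where

  onset-or-absent : ∀ N → (∃[ n ] (¬ P n × P (suc n))) ⊎ (∀ n → n ≤ N → ¬ P n)
  onset-or-absent zero = inj₂ λ { zero _ → ¬P0 }
  onset-or-absent (suc N) with onset-or-absent N
  ... | inj₁ onset = inj₁ onset
  ... | inj₂ absent with P? (suc N)
  ...   | yes p = inj₁ (N , absent N ≤-refl , p)
  ...   | no ¬p = inj₂ absent′
    where
    absent′ : ∀ n → n ≤ suc N → ¬ P n
    absent′ n n≤ with m≤n⇒m<n∨m≡n n≤
    ... | inj₁ n<suc = absent n (≤-pred n<suc)
    ... | inj₂ refl = ¬p

∃-suffix? : {Q : List A → Set q} → (∀ r → Dec (Q r)) →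
            ∀ v → Dec (∃[ x ] ∃[ r ] (x ++ r ≡ v × Q r))
∃-suffix? Q? v with Q? v
... | yes q = yes ([] , v , refl , q)
∃-suffix? Q? [] | no ¬q = no λ { ([] , _ , refl , q) → ¬q q ; (_ ∷ _ , _ , () , _) }
∃-suffix? {Q = Q} Q? (a ∷ v) | no ¬q = map′ extend shorten (∃-suffix? Q? v)
  where
  extend : ∃[ x ] ∃[ r ] (x ++ r ≡ v × Q r) → ∃[ x ] ∃[ r ] (x ++ r ≡ a ∷ v × Q r)
  extend (x , r , xr≡v , q) = a ∷ x , r , cong (a ∷_) xr≡v , q
  shorten : ∃[ x ] ∃[ r ] (x ++ r ≡ a ∷ v × Q r) → ∃[ x ] ∃[ r ] (x ++ r ≡ v × Q r)
  shorten ([] , _ , refl , q) = ⊥-elim (¬q q)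
  shorten (_ ∷ x , r , refl , q) = x , r , refl , q

take-length-++ : ∀ (p s : List A) → take (length p) (p ++ s) ≡ p
take-length-++ [] s = refl
take-length-++ (a ∷ p) s = cong (a ∷_) (take-length-++ p s)

length-take-≤ : ∀ {n} (v : List A) → n ≤ length v → length (take n v) ≡ n
length-take-≤ {n = n} v n≤|v| = trans (length-take n v) (m≤n⇒m⊓n≡m n≤|v|)

length-∷ʳ : ∀ (u : List A) a → length (u ∷ʳ a) ≡ suc (length u)
length-∷ʳ u a = trans (length-++ u) (+-comm _ 1)

prefix⇒length≤ : ∀ {p w} → IsPrefix p w → length p ≤ length w
prefix⇒length≤ {p} (s , refl) = length-++-≤ˡ p

take-prefix : ∀ {p w n} → IsPrefix p w → length p ≡ n → take n w ≡ p
take-prefix {p} (s , refl) refl = take-length-++ p s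

occ-++ : ∀ a x y → occ a (x ++ y) ≡ occ a x + occ a y
occ-++ a [] y = refl
occ-++ b0 (b0 ∷ x) y = cong suc (occ-++ b0 x y)
occ-++ b0 (b1 ∷ x) y = occ-++ b0 x y
occ-++ b1 (b0 ∷ x) y = occ-++ b1 x y
occ-++ b1 (b1 ∷ x) y = cong suc (occ-++ b1 x y)

length≡occ+occ : ∀ v → length v ≡ occ b0 v + occ b1 v
length≡occ+occ [] = refl
length≡occ+occ (b0 ∷ v) = cong suc (length≡occ+occ v)
length≡occ+occ (b1 ∷ v) = trans (cong suc (length≡occ+occ v)) (sym (+-suc _ _))

abelianEquiv : ∀ u v → length u ≡ length v → ones u ≡ ones v → AbelianEquiv u v
abelianEquiv u v |u|≡|v| ones≡ b0 = +-cancelʳ-≡ _ _ _ (begin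
  occ b0 u + ones u  ≡⟨ sym (length≡occ+occ u) ⟩
  length u           ≡⟨ |u|≡|v| ⟩
  length v           ≡⟨ length≡occ+occ v ⟩
  occ b0 v + ones v  ≡⟨ cong (occ b0 v +_) (sym ones≡) ⟩
  occ b0 v + ones u  ∎)
  where open ≡-Reasoning
abelianEquiv u v |u|≡|v| ones≡ b1 = ones≡

ones-∷ʳ : ∀ u a → ones (u ∷ʳ a) ≡ ones u + ones (a ∷ [])
ones-∷ʳ u a = occ-++ b1 u (a ∷ [])

∷ʳ-overtaken : ∀ u u′ a c → ones u′ ≤ ones u → ones (u ∷ʳ a) < ones (c ∷ u′) →
               a ≡ b0 × c ≡ b1 × ones u ≡ ones u′
∷ʳ-overtaken u u′ a b0 u′≤u lt =
  ⊥-elim (<⇒≱ lt (≤-trans u′≤u (≤-trans (m≤m+n _ _) (≤-reflexive (sym (ones-∷ʳ u a))))))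
∷ʳ-overtaken u u′ b1 b1 u′≤u lt rewrite ones-∷ʳ u b1 =
  ⊥-elim (<⇒≱ (subst (_≤ ones u′) (+-comm _ 1) (≤-pred lt)) u′≤u)
∷ʳ-overtaken u u′ b0 b1 u′≤u lt rewrite ones-∷ʳ u b0 =
  refl , refl , ≤-antisym (subst (_≤ ones u′) (+-identityʳ _) (≤-pred lt)) u′≤u

record Violation (w : Word) (n : ℕ) : Set where
  constructor violation
  field
    {prefix factor} : Word
    isPrefix  : IsPrefix prefix w
    isFactor  : IsFactor factor w
    |prefix|  : length prefix ≡ n
    |factor|  : length factor ≡ n
    overtakes : ones prefix < ones factor

¬violation-0 : ∀ {w} → ¬ Violation w 0
¬violation-0 (violation {[]} {[]} _ _ _ _ ())

-- A factor of length n is the length-n prefix of some suffix at least n long.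
violation? : ∀ w n → Dec (Violation w n)
violation? w n = map′ fromSuffix toSuffix
  (∃-suffix? (λ r → n ≤? length r ×-dec ones (take n w) <? ones (take n r)) w)
  where
  fromSuffix : ∃[ x ] ∃[ r ] (x ++ r ≡ w × n ≤ length r × ones (take n w) < ones (take n r)) →
               Violation w n
  fromSuffix (x , r , xr≡w , n≤|r| , lt) = violation
    (drop n w , take++drop≡id n w)
    (x , drop n r , trans (cong (x ++_) (take++drop≡id n r)) xr≡w)
    (length-take-≤ w (≤-trans n≤|r| (subst (λ v → length r ≤ length v) xr≡w (length-++-≤ʳ r {x}))))
    (length-take-≤ r n≤|r|)
    lt
  toSuffix : Violation w n →
             ∃[ x ] ∃[ r ] (x ++ r ≡ w × n ≤ length r × ones (take n w) < ones (take n r))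
  toSuffix (violation {p} {f} pre (x , y , xfy≡w) |p| |f| lt) =
    x , f ++ y , xfy≡w , subst (_≤ length (f ++ y)) |f| (length-++-≤ˡ f) ,
    subst₂ (λ p′ f′ → ones p′ < ones f′)
      (sym (take-prefix pre |p|)) (sym (take-prefix (y , refl) |f|)) lt

prefixNormal : ∀ w → (∀ n → n ≤ length w → ¬ Violation w n) → PrefixNormal w
prefixNormal w none p f pre fac |p|≡|f| =
  ≮⇒≥ λ lt → none (length p) (prefix⇒length≤ pre) (violation pre fac refl (sym |p|≡|f|) lt)

AbelianPrefixFactor : Word → Set
AbelianPrefixFactor w =
  ∃[ u ] ∃[ u′ ] (AbelianEquiv u u′ × IsPrefix (u ++ b0 ∷ []) w × IsFactor (b1 ∷ u′) w)

minimal-violation-∷ʳ-∷ : ∀ {w n} u a c u′ → ¬ Violation w n →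
  IsPrefix (u ∷ʳ a) w → IsFactor (c ∷ u′) w → length u ≡ n → length u′ ≡ n →
  ones (u ∷ʳ a) < ones (c ∷ u′) → AbelianPrefixFactor w
minimal-violation-∷ʳ-∷ u a c u′ ¬v pre@(s , us≡w) fac@(x , y , xfy≡w) |u| |u′| lt
  with ∷ʳ-overtaken u u′ a c u′≤u lt
  where
  u′≤u : ones u′ ≤ ones u
  u′≤u = ≮⇒≥ λ lt′ → ¬v (violation
    (a ∷ s , trans (sym (++-assoc u (a ∷ []) s)) us≡w)
    (x ∷ʳ c , y , trans (++-assoc x (c ∷ []) (u′ ++ y)) xfy≡w)
    |u| |u′| lt′)
... | refl , refl , ones≡ = u , u′ , abelianEquiv u u′ (trans |u| (sym |u′|)) ones≡ , pre , fac

minimal-violation : ∀ {w n} → ¬ Violation w n → Violation w (suc n) → AbelianPrefixFactor w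
minimal-violation ¬v (violation {p} {f} pre fac |p| |f| lt) with initLast p | f
... | [] | _ = ⊥-elim (0≢1+n |p|)
... | _ ∷ʳ′ _ | [] = ⊥-elim (0≢1+n |f|)
... | u ∷ʳ′ a | c ∷ u′ = minimal-violation-∷ʳ-∷ u a c u′ ¬v pre fac
  (suc-injective (trans (sym (length-∷ʳ u a)) |p|)) (suc-injective |f|) lt

lemma8 : (w : Word) → ¬ PrefixNormal w →
    ∃[ u ] ∃[ u′ ] (AbelianEquiv u u′ × IsPrefix (u ++ b0 ∷ []) w × IsFactor (b1 ∷ u′) w)
lemma8 w ¬pn with onset-or-absent (violation? w) ¬violation-0 (length w)
... | inj₁ (n , ¬vₙ , vₙ₊₁) = minimal-violation ¬vₙ vₙ₊₁
... | inj₂ absent = ⊥-elim (¬pn (prefixNormal w absent))
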